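{- Let $\mathcal{F}$ be a class of simple finite graphs that is closed under taking subgraphs. Suppose that every $G\in\mathcal{F}$ satisfies $\chi''(G)\leq \Delta(G)+2$. Then Hadwiger's conjecture holds for every graph in $T(\mathcal{F})=\{T(G): G\in\mathcal{F}\}$, i.e. for every $G\in\mathcal{F}$ and every integer $t>0$, if $\chi(T(G))\geq t$ then $T(G)$ contains $K_t$ as a minor.
   Context: $\Delta(G)$ is the maximum degree of $G$. A total coloring of $G$ assigns colors to $V(G)\cup E(G)$ so that adjacent vertices, adjacent edges, and an edge and either of its endpoints always receive distinct colors; $\chi''(G)$ is the minimum number of colors in a total coloring. The total graph $T(G)$ has vertex set $V(G)\cup E(G)$, two elements being adjacent in $T(G)$ if they are adjacent vertices, adjacent edges (sharing an endpoint), or an edge and one of its endpoints in $G$. A graph $H$ is a minor of $G$ if a graph isomorphic to $H$ can be obtained from $G$ by vertex deletions, edge deletions and edge contractions. -}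

module Defs where

open import Data.Nat using (ℕ; _+_; _⊔_; _<_)
open import Data.Fin using (Fin) renaming (_<_ to _<ᶠ_)
open import Data.Bool using (Bool; true; false; if_then_else_)
open import Data.List using (List; map; foldr; allFin)
open import Data.Nat.ListAction using (sum)
open import Data.Product using (Σ; _×_; ∃; _,_)
open import Data.Sum using (_⊎_; inj₁; inj₂)
open import Relation.Binary.PropositionalEquality using (_≡_; _≢_)
open import Relation.Nullary using (¬_)
open import Function.Definitions using (Injective)

record Graph : Set where
  field
    n     : ℕ
    adj   : Fin n → Fin n → Bool
    sym   : ∀ u v → adj u v ≡ adj v u
    irr   : ∀ u → adj u u ≡ false

open Graph public

Adj : (G : Graph) → Fin (n G) → Fin (n G) → Set
Adj G u v = adj G u v ≡ true

-- Edges of G: unordered pairs {u,v}, represented canonically with u < v.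
Edge : Graph → Set
Edge G = Σ (Fin (n G)) λ u → Σ (Fin (n G)) λ v → (u <ᶠ v) × Adj G u v

_∈ₑ_ : {G : Graph} → Fin (n G) → Edge G → Set
x ∈ₑ (u , v , _) = (x ≡ u) ⊎ (x ≡ v)

EdgesAdjacent : (G : Graph) → Edge G → Edge G → Set
EdgesAdjacent G e f = (e ≢ f) × ∃ λ (x : Fin (n G)) → (_∈ₑ_ {G} x e) × (_∈ₑ_ {G} x f)

degree : (G : Graph) → Fin (n G) → ℕ
degree G u = sum (map (λ v → if adj G u v then 1 else 0) (allFin (n G)))

Δ : Graph → ℕ
Δ G = foldr _⊔_ 0 (map (degree G) (allFin (n G)))

record TotalColoring (G : Graph) (k : ℕ) : Set where
  field
    cv : Fin (n G) → Fin k
    ce : Edge G → Fin k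
    vv : ∀ u v → Adj G u v → cv u ≢ cv v
    ee : ∀ e f → EdgesAdjacent G e f → ce e ≢ ce f
    ve : ∀ x e → _∈ₑ_ {G} x e → cv x ≢ ce e

TotalChromatic≤ : Graph → ℕ → Set
TotalChromatic≤ G k = TotalColoring G k

_⊑_ : Graph → Graph → Set
H ⊑ G = Σ (Fin (n H) → Fin (n G)) λ f →
          Injective _≡_ _≡_ f × (∀ u v → Adj H u v → Adj G (f u) (f v))

record RGraph : Set₁ where
  field
    V : Set
    E : V → V → Set

open RGraph public

TAdj : (G : Graph) → (Fin (n G) ⊎ Edge G) → (Fin (n G) ⊎ Edge G) → Set
TAdj G (inj₁ u) (inj₁ v) = Adj G u v
TAdj G (inj₁ u) (inj₂ e) = _∈ₑ_ {G} u e
TAdj G (inj₂ e) (inj₁ u) = _∈ₑ_ {G} u e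
TAdj G (inj₂ e) (inj₂ f) = EdgesAdjacent G e f

T : Graph → RGraph
T G = record { V = Fin (n G) ⊎ Edge G ; E = TAdj G }

Colorable : RGraph → ℕ → Set
Colorable H k = Σ (V H → Fin k) λ c → ∀ x y → E H x y → c x ≢ c y

χ≥ : RGraph → ℕ → Set
χ≥ H t = ∀ k → k < t → ¬ Colorable H k

data WalkIn (H : RGraph) (B : V H → Set) : V H → V H → Set where
  here : ∀ {x} → WalkIn H B x x
  step : ∀ {x y z} → E H x y → B y → WalkIn H B y z → WalkIn H B x z

record KMinorModel (H : RGraph) (t : ℕ) : Set₁ where
  field
    branch    : Fin t → V H → Set
    nonempty  : ∀ i → ∃ λ x → branch i x
    disjoint  : ∀ i j x → branch i x → branch j x → i ≡ j
    connected : ∀ i x y → branch i x → branch i y → WalkIn H (branch i) x y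
    joined    : ∀ i j → i ≢ j → ∃ λ x → ∃ λ y → branch i x × branch j y × E H x y

HasKMinor : RGraph → ℕ → Set₁
HasKMinor H t = KMinorModel H t

-- By induction on the number of edges we show, for every t, that T(G) has a
-- K_{t+1} minor or is t-colourable. Let v have maximum degree Δ. The closed
-- star of v (v and its Δ edges) is a clique of T(G), which settles t ≤ Δ, and
-- a total colouring settles t ≥ Δ + 2. For t = Δ + 1 take a neighbour u of v
-- and its component C in G − v. If C contains every neighbour of v, then C is
-- a connected branch set adjacent to the whole star, giving K_{Δ+2}.
-- Otherwise split G into H₁, the edges meeting C, and H₂, the rest. Both are
-- smaller, and since deg_{H₁} v + deg_{H₂} v = Δ, their (Δ+1)-colourings of
-- T(Hᵢ) can be permuted so that v gets the same colour and the edges at v get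
-- disjoint colours; they then glue to a colouring of T(G).

{-# OPTIONS --safe #-}
module Submission where

open import Defs hiding (sym)
open import Axiom.UniquenessOfIdentityProofs using (module Decidable⇒UIP)
open import Data.Bool using (Bool; true; false; if_then_else_; _∧_; _∨_; not)
import Data.Bool.Properties as Bool
open import Data.Empty using (⊥)
open import Data.Fin using (Fin; zero; suc; _↑ˡ_; _↑ʳ_; splitAt; inject≤)
import Data.Fin.Permutation.Components as PC
import Data.Fin.Properties as Fin
open import Data.List using (List; []; _∷_; map; foldr; allFin; length; lookup; filter)
open import Data.List.Membership.Propositional using (_∈_; find; lose)
open import Data.List.Membership.Propositional.Properties
  using (∈-allFin; ∈-lookup; ∈-filter⁺; ∈-filter⁻)
open import Data.List.Properties using (map-cong)
open import Data.List.Relation.Unary.All as All using (All; []; _∷_)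
open import Data.List.Relation.Unary.AllPairs using (_∷_)
open import Data.List.Relation.Unary.Any using (Any; here; there; index; any?)
open import Data.List.Relation.Unary.Any.Properties using (lookup-index)
open import Data.List.Relation.Unary.Unique.Propositional using (Unique)
open import Data.List.Relation.Unary.Unique.Propositional.Properties using (allFin⁺; filter⁺)
open import Data.Nat using (ℕ; zero; suc; _+_; _<_; _≤_; _⊔_; z≤n; s≤s)
open import Data.Nat.Induction using (<-wellFounded)
open import Data.Nat.ListAction using (sum)
import Data.Nat.Properties as ℕ
open import Algebra.Properties.CommutativeSemigroup ℕ.+-commutativeSemigroup using (interchange)
open import Data.Product using (Σ; _×_; ∃; ∃₂; _,_; proj₁; proj₂)
open import Data.Sum as Sum using (_⊎_; inj₁; inj₂)
open import Data.Sum.Properties using (inj₂-injective)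
open import Data.Vec using (Vec; []; _∷_)
import Data.Vec as Vec
open import Data.Vec.Membership.Propositional using () renaming (_∈_ to _∈ᵥ_)
open import Data.Vec.Membership.Propositional.Properties using (∈-allFin⁺)
import Data.Vec.Relation.Unary.Any as VecAny
open import Function using (_∘_; id)
open import Function.Definitions using (Injective)
open import Induction.WellFounded using (Acc; acc)
open import Relation.Binary.Definitions using (tri<; tri≈; tri>)
open import Relation.Binary.PropositionalEquality
open import Relation.Nullary using (¬_; Dec; yes; no; does; contradiction; ¬?; _×-dec_)
open import Relation.Nullary.Decidable using (dec-true; dec-false; map′)
open import Relation.Unary using (Decidable)

indicator : Bool → ℕ
indicator b = if b then 1 else 0

indicator-∧-split : ∀ a b → indicator (a ∧ b) + indicator (a ∧ not b) ≡ indicator a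
indicator-∧-split true  true  = refl
indicator-∧-split true  false = refl
indicator-∧-split false _     = refl

module _ {A : Set} where

  sum-map-member : (f : A → ℕ) {x : A} {xs : List A} → x ∈ xs → f x ≤ sum (map f xs)
  sum-map-member f {xs = y ∷ _}  (here refl) = ℕ.m≤m+n (f y) _
  sum-map-member f {xs = y ∷ _}  (there x∈)  =
    ℕ.≤-trans (sum-map-member f x∈) (ℕ.m≤n+m _ (f y))

  sum-map-+ : (f g : A → ℕ) (xs : List A) →
              sum (map f xs) + sum (map g xs) ≡ sum (map (λ x → f x + g x) xs)
  sum-map-+ f g []       = refl
  sum-map-+ f g (x ∷ xs) =
    trans (interchange (f x) _ (g x) _) (cong (f x + g x +_) (sum-map-+ f g xs))

  max-map-member : (f : A → ℕ) {x : A} {xs : List A} → x ∈ xs →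
                   f x ≤ foldr _⊔_ 0 (map f xs)
  max-map-member f {xs = y ∷ _} (here refl) = ℕ.m≤m⊔n (f y) _
  max-map-member f {xs = y ∷ _} (there x∈)  =
    ℕ.≤-trans (max-map-member f x∈) (ℕ.m≤n⊔m (f y) _)

  max-map-attained : (f : A → ℕ) {x : A} {xs : List A} → x ∈ xs →
                     ∃ λ y → foldr _⊔_ 0 (map f xs) ≡ f y
  max-map-attained f {xs = y ∷ []}     _ = y , ℕ.⊔-identityʳ (f y)
  max-map-attained f {xs = y ∷ z ∷ xs} _ with max-map-attained f {xs = z ∷ xs} (here refl)
  ... | m , max≡ with ℕ.⊔-sel (f y) (foldr _⊔_ 0 (map f (z ∷ xs)))
  ...   | inj₁ ⊔≡y = y , ⊔≡y
  ...   | inj₂ ⊔≡m = m , trans ⊔≡m max≡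

  length-filter : (p : A → Bool) (xs : List A) →
                  length (filter (λ x → p x Bool.≟ true) xs) ≡ sum (map (indicator ∘ p) xs)
  length-filter p []       = refl
  length-filter p (x ∷ xs) with p x
  ... | true  = cong suc (length-filter p xs)
  ... | false = length-filter p xs

  lookup-injective : {xs : List A} → Unique xs → Injective _≡_ _≡_ (lookup xs)
  lookup-injective {_ ∷ _} _            {zero}  {zero}  _  = refl
  lookup-injective {_ ∷ _} (x∉ ∷ _)     {zero}  {suc j} eq =
    contradiction eq (All.lookup x∉ (∈-lookup j))
  lookup-injective {_ ∷ _} (x∉ ∷ _)     {suc i} {zero}  eq =
    contradiction (sym eq) (All.lookup x∉ (∈-lookup i))
  lookup-injective {_ ∷ _} (_ ∷ unique) {suc i} {suc j} eq = cong suc (lookup-injective unique eq)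

module _ {A : Set} {P : A → Set} (P? : Decidable P) where

  extract : ∀ {m} (xs : Vec A (suc m)) →
            (∃₂ λ y (ys : Vec A m) → P y × (∀ {z} → z ∈ᵥ xs → z ≡ y ⊎ z ∈ᵥ ys))
            ⊎ (∀ {z} → z ∈ᵥ xs → ¬ P z)
  extract (x ∷ xs) with P? x
  ... | yes px =
    inj₁ (x , xs , px , λ { (VecAny.here z≡x) → inj₁ z≡x ; (VecAny.there z∈) → inj₂ z∈ })
  extract (x ∷ []) | no ¬px = inj₂ λ { (VecAny.here refl) → ¬px }
  extract (x ∷ xs@(_ ∷ _)) | no ¬px with extract xs
  ... | inj₁ (y , ys , py , cover) =
    inj₁ (y , x ∷ ys , py , λ { (VecAny.here z≡x) → inj₂ (VecAny.here z≡x)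
                               ; (VecAny.there z∈) → Sum.map₂ VecAny.there (cover z∈) })
  ... | inj₂ none = inj₂ λ { (VecAny.here refl) → ¬px ; (VecAny.there z∈) → none z∈ }

does-true⇒ : {A : Set} (a? : Dec A) → does a? ≡ true → A
does-true⇒ (yes a) _ = a

fin-or-empty : (m : ℕ) → Fin m ⊎ ¬ Fin m
fin-or-empty zero    = inj₂ λ ()
fin-or-empty (suc m) = inj₁ zero

↑ˡ≢↑ʳ : ∀ {m n} (i : Fin m) (j : Fin n) → i ↑ˡ n ≢ m ↑ʳ j
↑ˡ≢↑ʳ {m} {n} i j eq
  with trans (sym (Fin.splitAt-↑ˡ m i n)) (trans (cong (splitAt m) eq) (Fin.splitAt-↑ʳ m n j))
... | ()

module _ {k : ℕ} where

  transpose-injective : (i j : Fin k) → Injective _≡_ _≡_ (PC.transpose i j)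
  transpose-injective i j {x} {y} eq =
    trans (sym (PC.transpose-inverse j i))
          (trans (cong (PC.transpose j i) eq) (PC.transpose-inverse j i))

  transpose-matchˡ : (i j : Fin k) → PC.transpose i j i ≡ j
  transpose-matchˡ i j rewrite dec-true (i Fin.≟ i) refl = refl

  transpose-fix : (i j x : Fin k) → x ≢ i → x ≢ j → PC.transpose i j x ≡ x
  transpose-fix i j x x≢i x≢j
    rewrite dec-false (x Fin.≟ i) x≢i | dec-false (x Fin.≟ j) x≢j = refl

extend-injection : ∀ {m k} (f g : Fin m → Fin k) → Injective _≡_ _≡_ f → Injective _≡_ _≡_ g →
           Σ (Fin k → Fin k) λ σ → Injective _≡_ _≡_ σ × (∀ i → σ (f i) ≡ g i)
extend-injection {zero}  f g _     _     = id , id , λ ()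
extend-injection {suc m} f g f-inj g-inj
  with extend-injection (f ∘ suc) (g ∘ suc) (Fin.suc-injective ∘ f-inj) (Fin.suc-injective ∘ g-inj)
... | σ , σ-inj , σf≡g = τ ∘ σ , σ-inj ∘ transpose-injective (σ (f zero)) (g zero) , τσf≡g
  where
  τ : Fin _ → Fin _
  τ = PC.transpose (σ (f zero)) (g zero)
  τσf≡g : ∀ i → τ (σ (f i)) ≡ g i
  τσf≡g zero    = transpose-matchˡ (σ (f zero)) (g zero)
  τσf≡g (suc i) = trans (cong τ (σf≡g i))
    (transpose-fix _ _ (g (suc i))
      (λ eq → contradiction (f-inj (σ-inj (trans (σf≡g i) eq))) λ ())
      (λ eq → contradiction (g-inj eq) λ ()))

-- Minors

module _ {H : RGraph} {B : V H → Set} where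

  _++ʷ_ : ∀ {x y z} → WalkIn H B x y → WalkIn H B y z → WalkIn H B x z
  here       ++ʷ q = q
  step e b p ++ʷ q = step e b (p ++ʷ q)

mapWalk : {H H′ : RGraph} {B : V H → Set} {B′ : V H′ → Set} (f : V H → V H′) →
          (∀ {x y} → E H x y → E H′ (f x) (f y)) → (∀ {x} → B x → B′ (f x)) →
          ∀ {x y} → WalkIn H B x y → WalkIn H′ B′ (f x) (f y)
mapWalk f f-E f-B here         = here
mapWalk f f-E f-B (step e b p) = step (f-E e) (f-B b) (mapWalk f f-E f-B p)

module _ {H : RGraph} where

  KMinorModel-≤ : ∀ {s t} → t ≤ s → KMinorModel H s → KMinorModel H t
  KMinorModel-≤ t≤s M = record
    { branch    = branch ∘ ι
    ; nonempty  = nonempty ∘ ι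
    ; disjoint  = λ i j x bi bj → ι-injective (disjoint _ _ x bi bj)
    ; connected = connected ∘ ι
    ; joined    = λ i j i≢j → joined _ _ (i≢j ∘ ι-injective)
    }
    where
    open KMinorModel M
    ι : Fin _ → Fin _
    ι i = inject≤ i t≤s
    ι-injective : ∀ {i j} → ι i ≡ ι j → i ≡ j
    ι-injective = Fin.inject≤-injective t≤s t≤s _ _

  clique⇒injective : ∀ {t} {f : Fin t → V H} → (∀ {x} → ¬ E H x x) →
                     (∀ i j → i ≢ j → E H (f i) (f j)) → Injective _≡_ _≡_ f
  clique⇒injective {f = f} irrefl clique {i} {j} fi≡fj with i Fin.≟ j
  ... | yes i≡j = i≡j
  ... | no  i≢j = contradiction (subst (E H (f i)) (sym fi≡fj) (clique i j i≢j)) irrefl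

  cliqueModel : ∀ {t} → (∀ {x} → ¬ E H x x) → (f : Fin t → V H) →
                (∀ i j → i ≢ j → E H (f i) (f j)) → KMinorModel H t
  cliqueModel irrefl f clique = record
    { branch    = λ i x → x ≡ f i
    ; nonempty  = λ i → f i , refl
    ; disjoint  = λ { i j x refl fi≡fj → clique⇒injective irrefl clique fi≡fj }
    ; connected = λ { i x y refl refl → here }
    ; joined    = λ i j i≢j → f i , f j , refl , refl , clique i j i≢j
    }

  extendModel : ∀ {t} → (∀ {x y} → E H x y → E H y x) →
                (M : KMinorModel H t) (B : V H → Set) →
                ∃ B → (∀ x y → B x → B y → WalkIn H B x y) →
                (∀ i x → KMinorModel.branch M i x → ¬ B x) →
                (∀ i → ∃₂ λ x y → B x × KMinorModel.branch M i y × E H x y) →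
                KMinorModel H (suc t)
  extendModel E-sym M B B-nonempty B-connected B-disjoint B-joined = record
    { branch    = branch′
    ; nonempty  = λ { zero → B-nonempty ; (suc i) → nonempty i }
    ; disjoint  = disjoint′
    ; connected = λ { zero → B-connected ; (suc i) → connected i }
    ; joined    = joined′
    }
    where
    open KMinorModel M
    branch′ : Fin (suc _) → V H → Set
    branch′ zero    = B
    branch′ (suc i) = branch i
    disjoint′ : ∀ i j x → branch′ i x → branch′ j x → i ≡ j
    disjoint′ zero    zero    x _  _  = refl
    disjoint′ zero    (suc j) x bx bj = contradiction bx (B-disjoint j x bj)
    disjoint′ (suc i) zero    x bi bx = contradiction bx (B-disjoint i x bi)
    disjoint′ (suc i) (suc j) x bi bj = cong suc (disjoint i j x bi bj)
    joined′ : ∀ i j → i ≢ j → ∃₂ λ x y → branch′ i x × branch′ j y × E H x y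
    joined′ zero    zero    0≢0 = contradiction refl 0≢0
    joined′ zero    (suc j) _   = B-joined j
    joined′ (suc i) zero    _   with B-joined i
    ... | x , y , bx , bi , e = y , x , bi , bx , E-sym e
    joined′ (suc i) (suc j) i≢j = joined i j (i≢j ∘ cong suc)

KMinorModel-map : {H H′ : RGraph} {t : ℕ} (f : V H → V H′) → Injective _≡_ _≡_ f →
                  (∀ {x y} → E H x y → E H′ (f x) (f y)) → KMinorModel H t → KMinorModel H′ t
KMinorModel-map {H} {H′} {t} f f-inj f-E M = record
  { branch    = image
  ; nonempty  = λ i → let x , bx = nonempty i in f x , x , refl , bx
  ; disjoint  = λ { i j _ (x , refl , bx) (x′ , fx′≡fx , bx′) →
                    disjoint i j x bx (subst (branch j) (f-inj fx′≡fx) bx′) }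
  ; connected = λ { i _ _ (x , refl , bx) (y , refl , by) →
                    mapWalk f f-E (λ {z} bz → z , refl , bz) (connected i x y bx by) }
  ; joined    = λ i j i≢j → let x , y , bx , by , e = joined i j i≢j in
                  f x , f y , (x , refl , bx) , (y , refl , by) , f-E e
  }
  where
  open KMinorModel M
  image : Fin t → V H′ → Set
  image i y = ∃ λ x → f x ≡ y × branch i x

-- Colourings

Proper : (H : RGraph) {k : ℕ} → (V H → Fin k) → Set
Proper H c = ∀ x y → E H x y → c x ≢ c y

recolour : {H : RGraph} {k k′ : ℕ} {σ : Fin k → Fin k′} → Injective _≡_ _≡_ σ →
           Colorable H k → Colorable H k′
recolour {σ = σ} σ-inj (c , proper) = σ ∘ c , λ x y e → proper x y e ∘ σ-inj

Colorable-mono : {H : RGraph} {k k′ : ℕ} → k ≤ k′ → Colorable H k → Colorable H k′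
Colorable-mono k≤k′ = recolour (Fin.inject≤-injective k≤k′ k≤k′ _ _)

proper-injective-on-clique : {H : RGraph} {k m : ℕ} {c : V H → Fin k} → Proper H c →
                             (f : Fin m → V H) → (∀ i j → i ≢ j → E H (f i) (f j)) →
                             Injective _≡_ _≡_ (c ∘ f)
proper-injective-on-clique proper f clique {i} {j} eq with i Fin.≟ j
... | yes i≡j = i≡j
... | no  i≢j = contradiction eq (proper _ _ (clique i j i≢j))

-- Edges, neighbours and degrees

Bool-UIP : {a b : Bool} (p q : a ≡ b) → p ≡ q
Bool-UIP = Decidable⇒UIP.≡-irrelevant Bool._≟_

module _ (G : Graph) where

  adj-sym : ∀ {x y} → Adj G x y → Adj G y x
  adj-sym {x} {y} a = trans (Graph.sym G y x) a

  adj⇒≢ : ∀ {x y} → Adj G x y → x ≢ y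
  adj⇒≢ {x} a refl = contradiction (trans (sym a) (irr G x)) λ ()

  T-sym : ∀ {p q} → E (T G) p q → E (T G) q p
  T-sym {inj₁ _} {inj₁ _} a                     = adj-sym a
  T-sym {inj₁ _} {inj₂ _} x∈                    = x∈
  T-sym {inj₂ _} {inj₁ _} x∈                    = x∈
  T-sym {inj₂ _} {inj₂ _} (f≢g , x , f∋x , g∋x) = f≢g ∘ sym , x , g∋x , f∋x

  T-irrefl : ∀ {p} → ¬ E (T G) p p
  T-irrefl {inj₁ _} a         = adj⇒≢ a refl
  T-irrefl {inj₂ _} (f≢f , _) = f≢f refl

  Edge-≡ : (e f : Edge G) → proj₁ e ≡ proj₁ f → proj₁ (proj₂ e) ≡ proj₁ (proj₂ f) → e ≡ f
  Edge-≡ (u , w , p , a) (.u , .w , q , b) refl refl =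
    cong₂ (λ p a → u , w , p , a) (Fin.<-irrelevant p q) (Bool-UIP a b)

  edge : ∀ {x y} → Adj G x y → Edge G
  edge {x} {y} a with Fin.<-cmp x y
  ... | tri< x<y _ _ = x , y , x<y , a
  ... | tri≈ _ x≡y _ = contradiction x≡y (adj⇒≢ a)
  ... | tri> _ _ y<x = y , x , y<x , adj-sym a

  ∈-edgeˡ : ∀ {x y} (a : Adj G x y) → _∈ₑ_ {G} x (edge a)
  ∈-edgeˡ {x} {y} a with Fin.<-cmp x y
  ... | tri< _ _ _   = inj₁ refl
  ... | tri≈ _ x≡y _ = contradiction x≡y (adj⇒≢ a)
  ... | tri> _ _ _   = inj₂ refl

  ∈-edgeʳ : ∀ {x y} (a : Adj G x y) → _∈ₑ_ {G} y (edge a)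
  ∈-edgeʳ {x} {y} a with Fin.<-cmp x y
  ... | tri< _ _ _   = inj₂ refl
  ... | tri≈ _ x≡y _ = contradiction x≡y (adj⇒≢ a)
  ... | tri> _ _ _   = inj₁ refl

  ∈-edge⁻ : ∀ {x y z} (a : Adj G x y) → _∈ₑ_ {G} z (edge a) → z ≡ x ⊎ z ≡ y
  ∈-edge⁻ {x} {y} a z∈ with Fin.<-cmp x y
  ... | tri< _ _ _   = z∈
  ... | tri≈ _ x≡y _ = contradiction x≡y (adj⇒≢ a)
  ... | tri> _ _ _   = Sum.swap z∈

  edge-injectiveʳ : ∀ {x y y′} (a : Adj G x y) (a′ : Adj G x y′) → edge a ≡ edge a′ → y ≡ y′
  edge-injectiveʳ a a′ eq with ∈-edge⁻ a′ (subst (_∈ₑ_ {G} _) eq (∈-edgeʳ a))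
  ... | inj₁ y≡x  = contradiction (sym y≡x) (adj⇒≢ a)
  ... | inj₂ y≡y′ = y≡y′

  edge-cong : ∀ {x y y′} (a : Adj G x y) (a′ : Adj G x y′) → y ≡ y′ → edge a ≡ edge a′
  edge-cong a a′ refl = cong edge (Bool-UIP a a′)

  edge-through : ∀ {x} (e : Edge G) → _∈ₑ_ {G} x e →
                 ∃ λ y → Σ (Adj G x y) λ a → edge a ≡ e
  edge-through e@(u , w , _ , a) (inj₁ refl) =
    w , a , Edge-≡ (edge a) e (proj₁ ends) (proj₂ ends)
    where
    ends : proj₁ (edge a) ≡ u × proj₁ (proj₂ (edge a)) ≡ w
    ends with Fin.<-cmp u w
    ... | tri< _ _ _   = refl , refl
    ... | tri≈ _ u≡w _ = contradiction u≡w (adj⇒≢ a)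
    ... | tri> _ _ w<u = contradiction w<u (ℕ.<-asym (proj₁ (proj₂ (proj₂ e))))
  edge-through e@(u , w , _ , a) (inj₂ refl) =
    u , adj-sym a , Edge-≡ (edge (adj-sym a)) e (proj₁ ends) (proj₂ ends)
    where
    ends : proj₁ (edge (adj-sym a)) ≡ u × proj₁ (proj₂ (edge (adj-sym a))) ≡ w
    ends with Fin.<-cmp w u
    ... | tri< w<u _ _ = contradiction w<u (ℕ.<-asym (proj₁ (proj₂ (proj₂ e))))
    ... | tri≈ _ w≡u _ = contradiction (sym w≡u) (adj⇒≢ a)
    ... | tri> _ _ _   = refl , refl

  neighbours : Fin (n G) → List (Fin (n G))
  neighbours x = filter (λ y → adj G x y Bool.≟ true) (allFin (n G))

  neighbours-length : ∀ x → length (neighbours x) ≡ degree G x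
  neighbours-length x = length-filter (adj G x) (allFin (n G))

  neighbour : (x : Fin (n G)) → Fin (degree G x) → Fin (n G)
  neighbour x i = lookup (neighbours x) (subst Fin (sym (neighbours-length x)) i)

  neighbour-adj : ∀ x i → Adj G x (neighbour x i)
  neighbour-adj x i =
    proj₂ (∈-filter⁻ (λ y → adj G x y Bool.≟ true) {xs = allFin (n G)} (∈-lookup _))

  neighbour-injective : ∀ x → Injective _≡_ _≡_ (neighbour x)
  neighbour-injective x =
    subst-injective (sym (neighbours-length x))
    ∘ lookup-injective (filter⁺ (λ y → adj G x y Bool.≟ true) (allFin⁺ (n G)))

  neighbour-surjective : ∀ {x y} → Adj G x y → ∃ λ i → neighbour x i ≡ y
  neighbour-surjective {x} {y} a =
    subst Fin (neighbours-length x) (index y∈) ,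
    trans (cong (lookup (neighbours x)) (subst-sym-subst (neighbours-length x)))
          (sym (lookup-index y∈))
    where
    y∈ : y ∈ neighbours x
    y∈ = ∈-filter⁺ (λ y → adj G x y Bool.≟ true) (∈-allFin y) a

  adj⇒0<degree : ∀ {x y} → Adj G x y → 0 < degree G x
  adj⇒0<degree a = let i , _ = neighbour-surjective a in ℕ.≤-<-trans z≤n (Fin.toℕ<n i)

  star : (x : Fin (n G)) → Fin (degree G x) → Edge G
  star x i = edge (neighbour-adj x i)

  ∈-star : ∀ x i → _∈ₑ_ {G} x (star x i)
  ∈-star x i = ∈-edgeˡ (neighbour-adj x i)

  star-injective : ∀ x → Injective _≡_ _≡_ (star x)
  star-injective x = neighbour-injective x ∘ edge-injectiveʳ (neighbour-adj x _) (neighbour-adj x _)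

  star-surjective : ∀ {x} e → _∈ₑ_ {G} x e → ∃ λ i → star x i ≡ e
  star-surjective e x∈ with edge-through e x∈
  ... | y , a , edge≡e with neighbour-surjective a
  ...   | i , nb≡y = i , trans (edge-cong _ a nb≡y) edge≡e

  closedStar : (x : Fin (n G)) → Fin (suc (degree G x)) → V (T G)
  closedStar x zero    = inj₁ x
  closedStar x (suc i) = inj₂ (star x i)

  closedStar-clique : ∀ x i j → i ≢ j → E (T G) (closedStar x i) (closedStar x j)
  closedStar-clique x zero    zero    0≢0 = contradiction refl 0≢0
  closedStar-clique x zero    (suc j) _   = ∈-star x j
  closedStar-clique x (suc i) zero    _   = ∈-star x i
  closedStar-clique x (suc i) (suc j) i≢j =
    i≢j ∘ cong suc ∘ star-injective x , x , ∈-star x i , ∈-star x j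

  starMinor : ∀ x → HasKMinor (T G) (suc (degree G x))
  starMinor x = cliqueModel T-irrefl (closedStar x) (closedStar-clique x)

  degree≤Δ : ∀ x → degree G x ≤ Δ G
  degree≤Δ x = max-map-member (degree G) (∈-allFin x)

  Δ-attained : Fin (n G) → ∃ λ v → Δ G ≡ degree G v
  Δ-attained x = max-map-attained (degree G) (∈-allFin x)

  degreeSum : ℕ
  degreeSum = sum (map (degree G) (allFin (n G)))

  adj⇒0<degreeSum : ∀ {x y} → Adj G x y → 0 < degreeSum
  adj⇒0<degreeSum {x} a = ℕ.<-≤-trans (adj⇒0<degree a) (sum-map-member (degree G) (∈-allFin x))

  edgeless⇒T-colourable : (∀ x y → ¬ Adj G x y) → Colorable (T G) 1
  edgeless⇒T-colourable ¬adj = (λ _ → zero) , proper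
    where
    proper : Proper (T G) (λ _ → zero)
    proper (inj₁ x)               (inj₁ y)               a = λ _ → ¬adj x y a
    proper (inj₁ _)               (inj₂ (u , w , _ , a)) _ = λ _ → ¬adj u w a
    proper (inj₂ (u , w , _ , a)) _                      _ = λ _ → ¬adj u w a

  vertexless⇒T-colourable : ∀ {k} → ¬ Fin (n G) → Colorable (T G) k
  vertexless⇒T-colourable ¬x = colour , λ p _ _ _ → ¬x (vertexOf p)
    where
    vertexOf : V (T G) → Fin (n G)
    vertexOf (inj₁ x)       = x
    vertexOf (inj₂ (x , _)) = x
    colour : V (T G) → Fin _
    colour p = contradiction (vertexOf p) ¬x

  totalColoring⇒T-colourable : ∀ {k} → TotalColoring G k → Colorable (T G) k
  totalColoring⇒T-colourable τ = colour , proper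
    where
    open TotalColoring τ
    colour : V (T G) → Fin _
    colour (inj₁ x) = cv x
    colour (inj₂ f) = ce f
    proper : Proper (T G) colour
    proper (inj₁ x) (inj₁ y) a   = vv x y a
    proper (inj₁ x) (inj₂ f) x∈  = ve x f x∈
    proper (inj₂ f) (inj₁ x) x∈  = ve x f x∈ ∘ sym
    proper (inj₂ f) (inj₂ g) adj = ee f g adj

-- Spanning subgraphs

∧-trueˡ : ∀ {a b} → a ∧ b ≡ true → a ≡ true
∧-trueˡ {true} _ = refl

module Spanning (G : Graph) (keep : Fin (n G) → Fin (n G) → Bool)
                (keep-sym : ∀ x y → keep x y ≡ keep y x) where

  S : Graph
  S = record
    { n   = n G
    ; adj = λ x y → adj G x y ∧ keep x y
    ; sym = λ x y → cong₂ _∧_ (Graph.sym G x y) (keep-sym x y)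
    ; irr = λ x → cong (_∧ keep x x) (irr G x)
    }

  S⊑G : S ⊑ G
  S⊑G = id , id , λ _ _ → ∧-trueˡ

  restrictAdj : ∀ {x y} → Adj G x y → keep x y ≡ true → Adj S x y
  restrictAdj = cong₂ _∧_

  restrictEdge : (f : Edge G) → keep (proj₁ f) (proj₁ (proj₂ f)) ≡ true → Edge S
  restrictEdge (u , w , u<w , a) k = u , w , u<w , restrictAdj a k

  restrict-adjacent : ∀ {f g p q} → EdgesAdjacent G f g →
                      EdgesAdjacent S (restrictEdge f p) (restrictEdge g q)
  restrict-adjacent {f} {g} (f≢g , x , f∋x , g∋x) =
    (λ eq → f≢g (Edge-≡ G f g (cong proj₁ eq) (cong (proj₁ ∘ proj₂) eq))) , x , f∋x , g∋x

  embedEdge : Edge S → Edge G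
  embedEdge (u , w , u<w , a) = u , w , u<w , ∧-trueˡ a

  embedEdge-injective : Injective _≡_ _≡_ embedEdge
  embedEdge-injective {e} {f} eq = Edge-≡ S e f (cong proj₁ eq) (cong (proj₁ ∘ proj₂) eq)

  embed : V (T S) → V (T G)
  embed = Sum.map₂ embedEdge

  embed-injective : Injective _≡_ _≡_ embed
  embed-injective {inj₁ _} {inj₁ _} refl = refl
  embed-injective {inj₂ _} {inj₂ _} eq   = cong inj₂ (embedEdge-injective (inj₂-injective eq))

  embed-adj : ∀ {p q} → E (T S) p q → E (T G) (embed p) (embed q)
  embed-adj {inj₁ _} {inj₁ _} a                     = ∧-trueˡ a
  embed-adj {inj₁ _} {inj₂ _} x∈                    = x∈
  embed-adj {inj₂ _} {inj₁ _} x∈                    = x∈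
  embed-adj {inj₂ _} {inj₂ _} (e≢f , x , e∋x , f∋x) = e≢f ∘ embedEdge-injective , x , e∋x , f∋x

  minor : ∀ {t} → HasKMinor (T S) t → HasKMinor (T G) t
  minor = KMinorModel-map embed embed-injective embed-adj

module Complementary (G : Graph) (keep : Fin (n G) → Fin (n G) → Bool)
                     (keep-sym : ∀ x y → keep x y ≡ keep y x) where

  module Inner = Spanning G keep keep-sym
  module Outer = Spanning G (λ x y → not (keep x y)) (λ x y → cong not (keep-sym x y))

  degree-split : ∀ x → degree Inner.S x + degree Outer.S x ≡ degree G x
  degree-split x = trans (sum-map-+ _ _ (allFin (n G)))
    (cong sum (map-cong (λ y → indicator-∧-split (adj G x y) (keep x y)) (allFin (n G))))

  degreeSum-split : degreeSum Inner.S + degreeSum Outer.S ≡ degreeSum G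
  degreeSum-split =
    trans (sum-map-+ _ _ (allFin (n G))) (cong sum (map-cong degree-split (allFin (n G))))

  degreeSum-inner< : ∀ {x y} → Adj Outer.S x y → degreeSum Inner.S < degreeSum G
  degreeSum-inner< a =
    subst (degreeSum Inner.S <_) degreeSum-split (ℕ.m<m+n _ (adj⇒0<degreeSum Outer.S a))

  degreeSum-outer< : ∀ {x y} → Adj Inner.S x y → degreeSum Outer.S < degreeSum G
  degreeSum-outer< a =
    subst (degreeSum Outer.S <_) degreeSum-split (ℕ.m<n+m _ (adj⇒0<degreeSum Inner.S a))

-- The component of u in G − v

module Component (G : Graph) (v u : Fin (n G)) (u≢v : u ≢ v) where

  open import Data.List.Membership.DecPropositional (Fin._≟_ {n G}) using (_∈?_)

  data Reach : Fin (n G) → Set where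
    start  : Reach u
    extend : ∀ {x y} → Reach x → Adj G x y → y ≢ v → Reach y

  Reach⇒≢v : ∀ {x} → Reach x → x ≢ v
  Reach⇒≢v start            = u≢v
  Reach⇒≢v (extend _ _ y≢v) = y≢v

  Closed : List (Fin (n G)) → Set
  Closed xs = ∀ {x y} → x ∈ xs → Adj G x y → y ≢ v → y ∈ xs

  Frontier : List (Fin (n G)) → Fin (n G) → Set
  Frontier xs y = y ≢ v × Any (λ x → Adj G x y) xs

  frontier? : ∀ xs → Decidable (Frontier xs)
  frontier? xs y = ¬? (y Fin.≟ v) ×-dec any? (λ x → adj G x y Bool.≟ true) xs

  record Explored : Set where
    field
      visited   : List (Fin (n G))
      reachable : All Reach visited
      u∈        : u ∈ visited
      closed    : Closed visited

  explore : ∀ {m} (xs : List (Fin (n G))) (unseen : Vec (Fin (n G)) m) →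
            All Reach xs → u ∈ xs → (∀ {y} → y ≢ v → y ∈ xs ⊎ y ∈ᵥ unseen) → Explored
  explore xs [] reach u∈ cover = record
    { visited = xs ; reachable = reach ; u∈ = u∈
    ; closed = λ _ _ y≢v → Sum.[ id , (λ ()) ] (cover y≢v) }
  explore xs unseen@(_ ∷ _) reach u∈ cover with extract (frontier? xs) unseen
  ... | inj₁ (y , rest , (y≢v , adjacent) , cover′) =
    explore (y ∷ xs) rest (new ∷ reach) (there u∈) cover″
    where
    new : Reach y
    new = let x , x∈ , a = find adjacent in extend (All.lookup reach x∈) a y≢v
    cover″ : ∀ {z} → z ≢ v → z ∈ y ∷ xs ⊎ z ∈ᵥ rest
    cover″ z≢v with cover z≢v
    ... | inj₁ z∈xs     = inj₁ (there z∈xs)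
    ... | inj₂ z∈unseen = Sum.map₁ here (cover′ z∈unseen)
  ... | inj₂ none = record { visited = xs ; reachable = reach ; u∈ = u∈ ; closed = closed }
    where
    closed : Closed xs
    closed x∈ a y≢v with cover y≢v
    ... | inj₁ y∈        = y∈
    ... | inj₂ y∈unseen  = contradiction (y≢v , lose x∈ a) (none y∈unseen)

  open Explored
    (explore (u ∷ []) (Vec.allFin (n G)) (start ∷ []) (here refl) (λ {y} _ → inj₂ (∈-allFin⁺ y)))

  Reach⇒visited : ∀ {x} → Reach x → x ∈ visited
  Reach⇒visited start              = u∈
  Reach⇒visited (extend r a y≢v)   = closed (Reach⇒visited r) a y≢v

  reach? : Decidable Reach
  reach? x = map′ (All.lookup reachable) Reach⇒visited (x ∈? visited)

  inside : Fin (n G) → Bool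
  inside x = does (reach? x)

  inside-sound : ∀ {x} → inside x ≡ true → Reach x
  inside-sound {x} = does-true⇒ (reach? x)

  inside-v : inside v ≡ false
  inside-v = dec-false (reach? v) (λ r → Reach⇒≢v r refl)

  inside-closed : ∀ {x y} → inside x ≡ true → Adj G x y → inside y ≡ false → y ≡ v
  inside-closed {y = y} p a q with y Fin.≟ v
  ... | yes y≡v = y≡v
  ... | no  y≢v =
    contradiction (trans (sym (dec-true (reach? y) (extend (inside-sound p) a y≢v))) q) λ ()

  Branch : V (T G) → Set
  Branch (inj₁ x) = Reach x
  Branch (inj₂ _) = ⊥

  walkFrom : ∀ {y} → Reach y → WalkIn (T G) Branch (inj₁ u) (inj₁ y)
  walkFrom start              = here
  walkFrom (extend r a y≢v)   = walkFrom r ++ʷ step a (extend r a y≢v) here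

  walkTo : ∀ {y} → Reach y → WalkIn (T G) Branch (inj₁ y) (inj₁ u)
  walkTo start            = here
  walkTo (extend r a _)   = step (adj-sym G a) r (walkTo r)

  Branch-connected : ∀ p q → Branch p → Branch q → WalkIn (T G) Branch p q
  Branch-connected (inj₁ _) (inj₁ _) rx ry = walkTo rx ++ʷ walkFrom ry

  starComponentMinor : Adj G v u → (∀ i → Reach (neighbour G v i)) →
                       HasKMinor (T G) (suc (suc (degree G v)))
  starComponentMinor v-u all-reach =
    extendModel (T-sym G) (starMinor G v) Branch (inj₁ u , start) Branch-connected disjoint joined
    where
    disjoint : ∀ i p → p ≡ closedStar G v i → ¬ Branch p
    disjoint zero    _ refl r = Reach⇒≢v r refl
    disjoint (suc i) _ refl ()
    joined : ∀ i → ∃₂ λ p q → Branch p × q ≡ closedStar G v i × E (T G) p q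
    joined zero    = inj₁ u , inj₁ v , start , refl , adj-sym G v-u
    joined (suc i) = inj₁ (neighbour G v i) , inj₂ (star G v i) , all-reach i , refl ,
                     ∈-edgeʳ G (neighbour-adj G v i)

-- Splitting G at v

recolour-closedStar : (H : Graph) (v : Fin (n H)) {k : ℕ} (g : Fin (suc (degree H v)) → Fin k) →
                      Injective _≡_ _≡_ g → Colorable (T H) k →
                      Σ (Colorable (T H) k) λ κ → ∀ i → proj₁ κ (closedStar H v i) ≡ g i
recolour-closedStar H v g g-inj (c , proper)
  with extend-injection (c ∘ closedStar H v) g
         (proper-injective-on-clique proper (closedStar H v) (closedStar-clique H v)) g-inj
... | σ , σ-inj , σ≡g = recolour σ-inj (c , proper) , σ≡g

MinorOrColourable : Graph → ℕ → Set₁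
MinorOrColourable G t = HasKMinor (T G) (suc t) ⊎ Colorable (T G) t

MinorOrColourableBelow : Graph → ℕ → Set₁
MinorOrColourableBelow G t = ∀ H → H ⊑ G → degreeSum H < degreeSum G → MinorOrColourable H t

-- c marks a union of components of G − v.
module Split (G : Graph) (v : Fin (n G)) (c : Fin (n G) → Bool) (c-v : c v ≡ false)
             (closed : ∀ {x y} → c x ≡ true → Adj G x y → c y ≡ false → y ≡ v) where

  touches : Fin (n G) → Fin (n G) → Bool
  touches x y = c x ∨ c y

  open Complementary G touches (λ x y → Bool.∨-comm (c x) (c y))

  H₁ H₂ : Graph
  H₁ = Inner.S
  H₂ = Outer.S

  inner-adjˡ : ∀ {x y} → Adj G x y → c x ≡ true → Adj H₁ x y
  inner-adjˡ {y = y} a cx = Inner.restrictAdj a (cong (_∨ c y) cx)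

  inner-adjʳ : ∀ {x y} → Adj G x y → c y ≡ true → Adj H₁ x y
  inner-adjʳ {x} a cy = Inner.restrictAdj a (trans (cong (c x ∨_) cy) (Bool.∨-zeroʳ (c x)))

  outer-adj : ∀ {x y} → Adj G x y → c x ≡ false → c y ≡ false → Adj H₂ x y
  outer-adj a cx cy = Outer.restrictAdj a (cong not (cong₂ _∨_ cx cy))

  touchesEdge : Edge G → Bool
  touchesEdge (u , w , _) = touches u w

  touches-∈ : ∀ {x} f → _∈ₑ_ {G} x f → c x ≡ true → touchesEdge f ≡ true
  touches-∈ (u , w , _) (inj₁ refl) cx = cong (_∨ c w) cx
  touches-∈ (u , w , _) (inj₂ refl) cx = trans (cong (c u ∨_) cx) (Bool.∨-zeroʳ (c u))

  ∈-touching⇒v : ∀ {x} f → _∈ₑ_ {G} x f → c x ≡ false → touchesEdge f ≡ true → x ≡ v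
  ∈-touching⇒v (u , w , _ , a) (inj₁ refl) cu t =
    closed (trans (sym (cong (_∨ c w) cu)) t) (adj-sym G a) cu
  ∈-touching⇒v (u , w , _ , a) (inj₂ refl) cw t =
    closed (trans (sym (trans (cong (c u ∨_) cw) (Bool.∨-identityʳ (c u)))) t) a cw

  module Glue {K : ℕ} (κ₁ : Colorable (T H₁) K) (κ₂ : Colorable (T H₂) K)
              (agree-v : proj₁ κ₁ (inj₁ v) ≡ proj₁ κ₂ (inj₁ v))
              (stars-disjoint : ∀ f g → _∈ₑ_ {H₁} v f → _∈ₑ_ {H₂} v g →
                                proj₁ κ₁ (inj₂ f) ≢ proj₁ κ₂ (inj₂ g)) where

    open Σ κ₁ renaming (proj₁ to c₁; proj₂ to proper₁)
    open Σ κ₂ renaming (proj₁ to c₂; proj₂ to proper₂)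

    vertexColour : Fin (n G) → Bool → Fin K
    vertexColour x true  = c₁ (inj₁ x)
    vertexColour x false = c₂ (inj₁ x)

    edgeColour : (f : Edge G) (b : Bool) → touchesEdge f ≡ b → Fin K
    edgeColour f true  t = c₁ (inj₂ (Inner.restrictEdge f t))
    edgeColour f false t = c₂ (inj₂ (Outer.restrictEdge f (cong not t)))

    vertex-vertex : ∀ {x y} → Adj G x y → ∀ b → c x ≡ b → ∀ b′ → c y ≡ b′ →
         vertexColour x b ≢ vertexColour y b′
    vertex-vertex a true  cx true  _  = proper₁ _ _ (inner-adjˡ a cx)
    vertex-vertex a true  cx false cy with closed cx a cy
    ... | refl = proper₁ _ _ (inner-adjˡ a cx) ∘ (λ eq → trans eq (sym agree-v))
    vertex-vertex a false cx true  cy = vertex-vertex (adj-sym G a) true cy false cx ∘ sym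
    vertex-vertex a false cx false cy = proper₂ _ _ (outer-adj a cx cy)

    vertex-edge : ∀ {x} f → _∈ₑ_ {G} x f → ∀ b → c x ≡ b → ∀ b′ (t : touchesEdge f ≡ b′) →
         vertexColour x b ≢ edgeColour f b′ t
    vertex-edge f x∈ true  _  true  _ = proper₁ (inj₁ _) (inj₂ _) x∈
    vertex-edge f x∈ true  cx false t = contradiction (trans (sym (touches-∈ f x∈ cx)) t) λ ()
    vertex-edge f x∈ false cx true  t with ∈-touching⇒v f x∈ cx t
    ... | refl = proper₁ (inj₁ v) (inj₂ _) x∈ ∘ trans agree-v
    vertex-edge f x∈ false _  false _ = proper₂ (inj₁ _) (inj₂ _) x∈

    edge-edge : ∀ f g → EdgesAdjacent G f g →
         ∀ b (t : touchesEdge f ≡ b) b′ (t′ : touchesEdge g ≡ b′) →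
         edgeColour f b t ≢ edgeColour g b′ t′
    edge-edge f g f~g true  _ true  _ = proper₁ (inj₂ _) (inj₂ _) (Inner.restrict-adjacent f~g)
    edge-edge f g f~g false _ false _ = proper₂ (inj₂ _) (inj₂ _) (Outer.restrict-adjacent f~g)
    edge-edge f g (_ , x , f∋x , g∋x) true t false t′ with c x in cx
    ... | true  = contradiction (trans (sym (touches-∈ g g∋x cx)) t′) λ ()
    ... | false with ∈-touching⇒v f f∋x cx t
    ...   | refl = stars-disjoint _ _ f∋x g∋x
    edge-edge f g f~g false t true t′ = edge-edge g f (T-sym G f~g) true t′ false t ∘ sym

    colouring : Colorable (T G) K
    colouring = colour , proper
      where
      colour : V (T G) → Fin K
      colour (inj₁ x) = vertexColour x (c x)
      colour (inj₂ f) = edgeColour f (touchesEdge f) refl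
      proper : Proper (T G) colour
      proper (inj₁ x) (inj₁ y) a   = vertex-vertex a (c x) refl (c y) refl
      proper (inj₁ x) (inj₂ f) x∈  = vertex-edge f x∈ (c x) refl (touchesEdge f) refl
      proper (inj₂ f) (inj₁ x) x∈  = vertex-edge f x∈ (c x) refl (touchesEdge f) refl ∘ sym
      proper (inj₂ f) (inj₂ g) f~g = edge-edge f g f~g (touchesEdge f) refl (touchesEdge g) refl

  d₁ d₂ : ℕ
  d₁ = degree H₁ v
  d₂ = degree H₂ v

  -- Colour 0 goes to v; H₁ uses colours 1 … d₁ at v, H₂ the colours d₁+1 … d₁+d₂.
  palette₁ : Fin (suc d₁) → Fin (suc (d₁ + d₂))
  palette₁ i = i ↑ˡ d₂

  palette₂ : Fin (suc d₂) → Fin (suc (d₁ + d₂))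
  palette₂ zero    = zero
  palette₂ (suc j) = suc (d₁ ↑ʳ j)

  palette₂-injective : Injective _≡_ _≡_ palette₂
  palette₂-injective {zero}  {zero}  _  = refl
  palette₂-injective {suc i} {suc j} eq = cong suc (Fin.↑ʳ-injective d₁ i j (Fin.suc-injective eq))

  combine : Colorable (T H₁) (suc (d₁ + d₂)) → Colorable (T H₂) (suc (d₁ + d₂)) →
            Colorable (T G) (suc (d₁ + d₂))
  combine κ₁ κ₂
    with recolour-closedStar H₁ v palette₁ (Fin.↑ˡ-injective d₂ _ _) κ₁
       | recolour-closedStar H₂ v palette₂ palette₂-injective κ₂
  ... | κ₁′ , κ₁′≡ | κ₂′ , κ₂′≡ =
    Glue.colouring κ₁′ κ₂′ (trans (κ₁′≡ zero) (sym (κ₂′≡ zero))) disjoint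
    where
    disjoint : ∀ f g → _∈ₑ_ {H₁} v f → _∈ₑ_ {H₂} v g →
               proj₁ κ₁′ (inj₂ f) ≢ proj₁ κ₂′ (inj₂ g)
    disjoint f g v∈f v∈g eq with star-surjective H₁ f v∈f | star-surjective H₂ g v∈g
    ... | i , refl | j , refl =
      ↑ˡ≢↑ʳ i j (Fin.suc-injective (trans (sym (κ₁′≡ (suc i))) (trans eq (κ₂′≡ (suc j)))))

  splitStep : ∀ {u w} → Adj G v u → c u ≡ true → Adj G v w → c w ≡ false →
              MinorOrColourableBelow G (suc (degree G v)) → MinorOrColourable G (suc (degree G v))
  splitStep v-u c-u v-w c-w IH
    with IH H₁ Inner.S⊑G (degreeSum-inner< (outer-adj v-w c-v c-w))
       | IH H₂ Outer.S⊑G (degreeSum-outer< (inner-adjʳ v-u c-u))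
  ... | inj₁ minor₁ | _           = inj₁ (Inner.minor minor₁)
  ... | inj₂ _      | inj₁ minor₂ = inj₁ (Outer.minor minor₂)
  ... | inj₂ κ₁     | inj₂ κ₂     =
    inj₂ (subst (Colorable (T G) ∘ suc) (degree-split v) (combine (resize κ₁) (resize κ₂)))
    where
    resize : ∀ {H} → Colorable (T H) (suc (degree G v)) → Colorable (T H) (suc (d₁ + d₂))
    resize {H} = subst (Colorable (T H) ∘ suc) (sym (degree-split v))

-- Induction on the number of edges

module Critical (G : Graph) (v : Fin (n G)) (IH : MinorOrColourableBelow G (suc (degree G v))) where

  module _ {u} (v-u : Adj G v u) where
    open Component G v u (adj⇒≢ G v-u ∘ sym)

    withNeighbour : MinorOrColourable G (suc (degree G v))
    withNeighbour with Fin.all? (λ i → reach? (neighbour G v i))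
    ... | yes all-reach = inj₁ (starComponentMinor v-u all-reach)
    ... | no ¬all-reach =
      let i , ¬reach = Fin.¬∀⟶∃¬ _ _ (λ i → reach? (neighbour G v i)) ¬all-reach in
      Split.splitStep G v inside inside-v inside-closed v-u (dec-true (reach? u) start)
        (neighbour-adj G v i) (dec-false (reach? (neighbour G v i)) ¬reach) IH

  maxDegreeCase : (∀ x → degree G x ≤ degree G v) → MinorOrColourable G (suc (degree G v))
  maxDegreeCase maximal with fin-or-empty (degree G v)
  ... | inj₁ i        = withNeighbour (neighbour-adj G v i)
  ... | inj₂ isolated = inj₂ (Colorable-mono (s≤s z≤n) (edgeless⇒T-colourable G edgeless))
    where
    edgeless : ∀ x y → ¬ Adj G x y
    edgeless x y a = isolated (inject≤ (proj₁ (neighbour-surjective G a)) (maximal x))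

module _ (𝓕 : Graph → Set) (𝓕-closed : ∀ {G H} → 𝓕 G → H ⊑ G → 𝓕 H)
         (𝓕-total : ∀ G → 𝓕 G → TotalChromatic≤ G (Δ G + 2)) where

  minorOrColourable : ∀ G → Acc _<_ (degreeSum G) → 𝓕 G → ∀ t → MinorOrColourable G t
  minorOrColourable G (acc rec) 𝓕G t with fin-or-empty (n G)
  ... | inj₂ no-vertex = inj₂ (vertexless⇒T-colourable G no-vertex)
  ... | inj₁ x with Δ-attained G x
  ...   | v , Δ≡deg with ℕ.<-cmp t (suc (Δ G))
  ...     | tri< t≤Δ _ _   =
    inj₁ (KMinorModel-≤ (subst (λ d → suc t ≤ suc d) Δ≡deg t≤Δ) (starMinor G v))
  ...     | tri> _ _ Δ+1<t =
    inj₂ (Colorable-mono (subst (_≤ t) (ℕ.+-comm 2 (Δ G)) Δ+1<t)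
                         (totalColoring⇒T-colourable G (𝓕-total G 𝓕G)))
  ...     | tri≈ _ refl _  = subst (MinorOrColourable G ∘ suc) (sym Δ≡deg)
    (Critical.maxDegreeCase G v (λ H H⊑G lt → minorOrColourable H (rec lt) (𝓕-closed 𝓕G H⊑G) _)
                                (λ y → subst (degree G y ≤_) Δ≡deg (degree≤Δ G y)))

theorem7 : (𝓕 : Graph → Set)
           → (∀ {G H} → 𝓕 G → H ⊑ G → 𝓕 H)
           → (∀ G → 𝓕 G → TotalChromatic≤ G (Δ G + 2))
           → ∀ G → 𝓕 G → (t : ℕ) → 0 < t → χ≥ (T G) t → HasKMinor (T G) t
theorem7 𝓕 𝓕-closed 𝓕-total G 𝓕G (suc t) _ χ≥t
  with minorOrColourable 𝓕 𝓕-closed 𝓕-total G (<-wellFounded _) 𝓕G t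
... | inj₁ minor     = minor
... | inj₂ colouring = contradiction colouring (χ≥t t (ℕ.n<1+n t))
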